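{- For all positive integers $a,d$ with $a<d$ there exists a sentence $\theta$ of ${\cal R}ing(0,+,*,<)$ such that for every prime $p>d$: $p\equiv a\pmod d$ if and only if $\mathbb{Z}_p\models\theta$.
   Context: For an integer $m\ge1$, $\mathbb{Z}_m$ is the finite residue class ring with universe $\{0,\ldots,m-1\}$ and addition and multiplication mod $m$. ${\cal R}ing(0,+,*,<)$ is the set of first-order formulas over a constant symbol $0$, binary function symbols $+,*$ and a binary relation symbol $<$, interpreted in $\mathbb{Z}_m$ as the residue class $0$, addition and multiplication mod $m$, and the natural order $0<1<\cdots<m-1$ of the representatives. -}

module Defs where

open import Data.Nat using (ℕ; zero; suc; _+_; _*_; _%_; _<_)
open import Data.Nat.DivMod using (m%n<n)
open import Data.Fin using (Fin; toℕ; fromℕ<)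
import Data.Fin as Fin
open import Data.Product using (Σ; _×_)
open import Data.Sum using (_⊎_)
open import Data.Empty using (⊥)
open import Relation.Binary.PropositionalEquality using (_≡_)

data Term (n : ℕ) : Set where
  var  : Fin n → Term n
  zer  : Term n
  _⊕_  : Term n → Term n → Term n
  _⊛_  : Term n → Term n → Term n

data Formula : ℕ → Set where
  _≐_   : ∀ {n} → Term n → Term n → Formula n
  _≺_   : ∀ {n} → Term n → Term n → Formula n
  ⊥f    : ∀ {n} → Formula n
  ¬f_   : ∀ {n} → Formula n → Formula n
  _∧f_  : ∀ {n} → Formula n → Formula n → Formula n
  _∨f_  : ∀ {n} → Formula n → Formula n → Formula n
  _⇒f_  : ∀ {n} → Formula n → Formula n → Formula n
  ∀f    : ∀ {n} → Formula (suc n) → Formula n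
  ∃f    : ∀ {n} → Formula (suc n) → Formula n

Sentence : Set
Sentence = Formula 0

-- The residue class ring Z_m for m = suc k ≥ 1: universe {0,...,m-1} (as Fin m).
addMod : ∀ k → Fin (suc k) → Fin (suc k) → Fin (suc k)
addMod k x y = fromℕ< (m%n<n (toℕ x + toℕ y) (suc k))

mulMod : ∀ k → Fin (suc k) → Fin (suc k) → Fin (suc k)
mulMod k x y = fromℕ< (m%n<n (toℕ x * toℕ y) (suc k))

extend : ∀ {A : Set} {n} → A → (Fin n → A) → Fin (suc n) → A
extend a ρ Fin.zero    = a
extend a ρ (Fin.suc i) = ρ i

evalT : ∀ k {n} → (Fin n → Fin (suc k)) → Term n → Fin (suc k)
evalT k ρ (var i) = ρ i
evalT k ρ zer     = Fin.zero
evalT k ρ (s ⊕ t) = addMod k (evalT k ρ s) (evalT k ρ t)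
evalT k ρ (s ⊛ t) = mulMod k (evalT k ρ s) (evalT k ρ t)

-- Satisfaction in Z_(suc k); < is the natural order of the representatives.
Sat : ∀ k {n} → (Fin n → Fin (suc k)) → Formula n → Set
Sat k ρ (s ≐ t)  = evalT k ρ s ≡ evalT k ρ t
Sat k ρ (s ≺ t)  = toℕ (evalT k ρ s) < toℕ (evalT k ρ t)
Sat k ρ ⊥f       = ⊥
Sat k ρ (¬f φ)   = Sat k ρ φ → ⊥
Sat k ρ (φ ∧f ψ) = Sat k ρ φ × Sat k ρ ψ
Sat k ρ (φ ∨f ψ) = Sat k ρ φ ⊎ Sat k ρ ψ
Sat k ρ (φ ⇒f ψ) = Sat k ρ φ → Sat k ρ ψ
Sat k ρ (∀f φ)   = (a : Fin (suc k)) → Sat k (extend a ρ) φ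
Sat k ρ (∃f φ)   = Σ (Fin (suc k)) (λ a → Sat k (extend a ρ) φ)

noVars : ∀ {A : Set} → Fin 0 → A
noVars ()

_⊨_ : (m : ℕ) → Sentence → Set
zero  ⊨ θ = ⊥   -- never used (m ≥ 1 in the paper)
suc k ⊨ θ = Sat k noVars θ

-- In Z_p the element 1 is definable as the least positive element, so every
-- numeral a is a term.  For 0 < x the multiples 0, x, 2x, …, dx increase in the
-- order of representatives exactly when dx < p, and then dx + a ≡ 0 (mod p) with
-- 0 < a < p means dx + a = p.  Hence the sentence "for some x the multiples
-- 0, x, …, dx increase and dx + a = 0" holds in Z_p iff p = dx + a for some x,
-- i.e. iff p ≡ a (mod d).
module Submission where

open import Defs
open import Data.Nat using (ℕ; zero; suc; _+_; _*_; _∸_; _%_; _/_; _≤_; _<_; _<?_; z<s; NonZero; >-nonZero; >-nonZero⁻¹)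
open import Data.Nat.Properties
open import Data.Nat.DivMod
open import Data.Nat.Primality using (Prime)
open import Data.Fin using (Fin; toℕ; fromℕ<)
import Data.Fin as Fin
open import Data.Fin.Properties using (toℕ-fromℕ<; toℕ-injective; toℕ<n)
open import Data.Product using (Σ; ∃-syntax; _,_)
open import Data.Empty using (⊥-elim)
open import Function.Bundles using (_⇔_; mk⇔; module Equivalence)
import Function.Properties.Equivalence as ⇔
open import Relation.Nullary using (yes; no)
open import Relation.Binary.PropositionalEquality
  using (_≡_; refl; sym; trans; cong; cong₂; subst; subst₂; module ≡-Reasoning)

m%n≡m∸n : ∀ {m n} .{{_ : NonZero n}} → n ≤ m → m < n + n → m % n ≡ m ∸ n
m%n≡m∸n {m} {n} n≤m m<2n =
  trans (sym (m≤n⇒[n∸m]%m≡n%m n≤m)) (m<n⇒m%n≡m (m<n+o⇒m∸n<o m n m<2n))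

m<[m+n]%o⇒m+n<o : ∀ {m n o} .{{_ : NonZero o}} →
                  m < o → n < o → m < (m + n) % o → m + n < o
m<[m+n]%o⇒m+n<o {m} {n} {o} m<o n<o m<[m+n]%o with m + n <? o
... | yes m+n<o = m+n<o
... | no m+n≮o = ⊥-elim (<⇒≱ m<[m+n]%o (begin
  (m + n) % o  ≡⟨ m%n≡m∸n (≮⇒≥ m+n≮o) (+-mono-< m<o n<o) ⟩
  m + n ∸ o    ≤⟨ ∸-monoˡ-≤ o (+-monoʳ-≤ m (<⇒≤ n<o)) ⟩
  m + o ∸ o    ≡⟨ m+n∸n≡m m o ⟩
  m            ∎))
  where open ≤-Reasoning

m%n≡0⇒m≡n : ∀ {m n} .{{_ : NonZero n}} → m % n ≡ 0 → 0 < m → m < n + n → m ≡ n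
m%n≡0⇒m≡n {m} {n} m%n≡0 0<m m<2n with m <? n
... | yes m<n = ⊥-elim (<⇒≢ 0<m (sym (trans (sym (m<n⇒m%n≡m m<n)) m%n≡0)))
... | no m≮n = ≤-antisym (m∸n≡0⇒m≤n (trans (sym (m%n≡m∸n (≮⇒≥ m≮n) m<2n)) m%n≡0)) (≮⇒≥ m≮n)

%≡⇔∃quotient : ∀ {p d a} .{{_ : NonZero d}} → a < d → (p % d ≡ a % d) ⇔ (∃[ q ] d * q + a ≡ p)
%≡⇔∃quotient {p} {d} {a} a<d = mk⇔ quotient remainder
  where
  quotient : p % d ≡ a % d → ∃[ q ] d * q + a ≡ p
  quotient p%d≡a%d = p / d , (begin
    d * (p / d) + a   ≡⟨ +-comm (d * (p / d)) a ⟩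
    a + d * (p / d)   ≡⟨ cong (a +_) (*-comm d (p / d)) ⟩
    a + p / d * d     ≡⟨ cong (_+ p / d * d) (trans p%d≡a%d (m<n⇒m%n≡m a<d)) ⟨
    p % d + p / d * d ≡⟨ m≡m%n+[m/n]*n p d ⟨
    p                 ∎)
    where open ≡-Reasoning
  remainder : ∃[ q ] d * q + a ≡ p → p % d ≡ a % d
  remainder (q , refl) = begin
    (d * q + a) % d  ≡⟨ %-congˡ (trans (+-comm (d * q) a) (cong (a +_) (*-comm d q))) ⟩
    (a + q * d) % d  ≡⟨ [m+kn]%n≡m%n a q d ⟩
    a % d            ∎
    where open ≡-Reasoning

_·_ : ∀ {n} → ℕ → Term n → Term n
zero  · t = zer
suc j · t = (j · t) ⊕ t

increasingMultiples : ∀ {n} → ℕ → Term n → Formula n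
increasingMultiples zero    t = ¬f ⊥f
increasingMultiples (suc j) t = increasingMultiples j t ∧f ((j · t) ≺ (suc j · t))

isOne : Formula 1
isOne = (zer ≺ var Fin.zero)
     ∧f ∀f (¬f ((zer ≺ var Fin.zero) ∧f (var Fin.zero ≺ var (Fin.suc Fin.zero))))

varX varOne : Term 2
varX   = var Fin.zero
varOne = var (Fin.suc Fin.zero)

residueSentence : ℕ → ℕ → Sentence
residueSentence d a = ∃f (isOne ∧f ∃f (increasingMultiples d varX ∧f (((d · varX) ⊕ (a · varOne)) ≐ zer)))

module Semantics (k : ℕ) where

  value : ∀ {n} → (Fin n → Fin (suc k)) → Term n → ℕ
  value ρ t = toℕ (evalT k ρ t)

  module _ {n} (ρ : Fin n → Fin (suc k)) where

    value-⊕ : ∀ s t → value ρ (s ⊕ t) ≡ (value ρ s + value ρ t) % suc k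
    value-⊕ s t = toℕ-fromℕ< (m%n<n (value ρ s + value ρ t) (suc k))

    value-· : ∀ j t → j * value ρ t < suc k → value ρ (j · t) ≡ j * value ρ t
    value-· zero    t _  = refl
    value-· (suc j) t [1+j]x<p = begin
      value ρ ((j · t) ⊕ t)         ≡⟨ value-⊕ (j · t) t ⟩
      (value ρ (j · t) + x) % suc k ≡⟨ %-congˡ (cong (_+ x) (value-· j t jx<p)) ⟩
      (j * x + x) % suc k           ≡⟨ %-congˡ (+-comm (j * x) x) ⟩
      (x + j * x) % suc k           ≡⟨ m<n⇒m%n≡m [1+j]x<p ⟩
      x + j * x                     ∎
      where
      open ≡-Reasoning
      x = value ρ t
      jx<p = ≤-<-trans (m≤n+m (j * x) x) [1+j]x<p

    increasing⇒noWrap : ∀ j t → Sat k ρ (increasingMultiples j t) → j * value ρ t < suc k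
    increasing⇒noWrap zero    t _ = z<s
    increasing⇒noWrap (suc j) t (increasing , step) = subst (_< suc k) (+-comm (j * x) x)
      (m<[m+n]%o⇒m+n<o jx<p (toℕ<n (evalT k ρ t)) (subst₂ _<_ (value-· j t jx<p) next≡ step))
      where
      x = value ρ t
      jx<p = increasing⇒noWrap j t increasing
      next≡ : value ρ (suc j · t) ≡ (j * x + x) % suc k
      next≡ = trans (value-⊕ (j · t) t) (%-congˡ (cong (_+ x) (value-· j t jx<p)))

    noWrap⇒increasing : ∀ j t → 0 < value ρ t → j * value ρ t < suc k →
                        Sat k ρ (increasingMultiples j t)
    noWrap⇒increasing zero    t _   _    ()
    noWrap⇒increasing (suc j) t 0<x [1+j]x<p =
      noWrap⇒increasing j t 0<x jx<p ,
      subst₂ _<_ (sym (value-· j t jx<p)) (sym (value-· (suc j) t [1+j]x<p)) (m<n+m (j * x) 0<x)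
      where
      x = value ρ t
      jx<p = ≤-<-trans (m≤n+m (j * x) x) [1+j]x<p

    value-numeral : ∀ a t → value ρ t ≡ 1 → a < suc k → value ρ (a · t) ≡ a
    value-numeral a t t≡1 a<p = trans (value-· a t a*t<p) a*t≡a
      where
      a*t≡a : a * value ρ t ≡ a
      a*t≡a = trans (cong (a *_) t≡1) (*-identityʳ a)
      a*t<p : a * value ρ t < suc k
      a*t<p = subst (_< suc k) (sym a*t≡a) a<p

  sat-isOne⇔ : 1 < suc k → (ρ : Fin 1 → Fin (suc k)) → Sat k ρ isOne ⇔ (toℕ (ρ Fin.zero) ≡ 1)
  sat-isOne⇔ 1<p ρ = mk⇔ isOne⇒≡1 ≡1⇒isOne
    where
    isOne⇒≡1 : Sat k ρ isOne → toℕ (ρ Fin.zero) ≡ 1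
    isOne⇒≡1 (0<o , nothingBelow) = ≤-antisym (≮⇒≥ λ 1<o → nothingBelow (fromℕ< 1<p)
      (subst (0 <_) 1≡toℕ1 z<s , subst (_< toℕ (ρ Fin.zero)) 1≡toℕ1 1<o)) 0<o
      where
      1≡toℕ1 : 1 ≡ toℕ (fromℕ< 1<p)
      1≡toℕ1 = sym (toℕ-fromℕ< 1<p)
    ≡1⇒isOne : toℕ (ρ Fin.zero) ≡ 1 → Sat k ρ isOne
    ≡1⇒isOne o≡1 = subst (0 <_) (sym o≡1) z<s , λ z (0<z , z<o) → <⇒≱ (subst (toℕ z <_) o≡1 z<o) 0<z

⊨residueSentence⇔ : ∀ {d a} p → 0 < d → 0 < a → a < p →
                    (p ⊨ residueSentence d a) ⇔ (∃[ q ] d * q + a ≡ p)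
⊨residueSentence⇔ {d} {a} (suc k) 0<d 0<a a<p = mk⇔ sat⇒quotient quotient⇒sat
  where
  open Semantics k
  p = suc k

  1<p : 1 < p
  1<p = ≤-<-trans 0<a a<p

  value-residue : (ρ : Fin 2 → Fin p) → value ρ varOne ≡ 1 → d * value ρ varX < p →
                  value ρ ((d · varX) ⊕ (a · varOne)) ≡ (d * value ρ varX + a) % p
  value-residue ρ one≡1 dx<p = trans (value-⊕ ρ (d · varX) (a · varOne))
    (%-congˡ (cong₂ _+_ (value-· ρ d varX dx<p) (value-numeral ρ a varOne one≡1 a<p)))

  sat⇒quotient : p ⊨ residueSentence d a → ∃[ q ] d * q + a ≡ p
  sat⇒quotient (o , isOne-o , x₀ , increasing , dx+a≡0) =
    toℕ x₀ , m%n≡0⇒m≡n residue≡0 (<-≤-trans 0<a (m≤n+m a (d * toℕ x₀))) (+-mono-< dx<p a<p)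
    where
    ρ : Fin 2 → Fin p
    ρ = extend x₀ (extend o noVars)
    dx<p : d * toℕ x₀ < p
    dx<p = increasing⇒noWrap ρ d varX increasing
    o≡1 : toℕ o ≡ 1
    o≡1 = Equivalence.to (sat-isOne⇔ 1<p (extend o noVars)) isOne-o
    residue≡0 : (d * toℕ x₀ + a) % p ≡ 0
    residue≡0 = trans (sym (value-residue ρ o≡1 dx<p)) (cong toℕ dx+a≡0)

  quotient⇒sat : ∃[ q ] d * q + a ≡ p → p ⊨ residueSentence d a
  quotient⇒sat (zero , a≡p) = ⊥-elim (<⇒≢ a<p (trans (cong (_+ a) (sym (*-zeroʳ d))) a≡p))
  quotient⇒sat (q@(suc _) , dq+a≡p) =
    o , Equivalence.from (sat-isOne⇔ 1<p (extend o noVars)) (toℕ-fromℕ< 1<p) ,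
    x₀ , noWrap⇒increasing ρ d varX (subst (0 <_) (sym x₀≡q) z<s) dx<p ,
    toℕ-injective (begin
      value ρ ((d · varX) ⊕ (a · varOne)) ≡⟨ value-residue ρ (toℕ-fromℕ< 1<p) dx<p ⟩
      (d * value ρ varX + a) % p          ≡⟨ %-congˡ (cong (λ v → d * v + a) x₀≡q) ⟩
      (d * q + a) % p                     ≡⟨ %-congˡ dq+a≡p ⟩
      p % p                               ≡⟨ n%n≡0 p ⟩
      0                                   ∎)
    where
    open ≡-Reasoning
    dq<p : d * q < p
    dq<p = subst (d * q <_) dq+a≡p (m<m+n (d * q) 0<a)
    q<p : q < p
    q<p = ≤-<-trans (m≤n*m q d {{>-nonZero 0<d}}) dq<p
    o : Fin p
    o = fromℕ< 1<p
    x₀ : Fin p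
    x₀ = fromℕ< q<p
    ρ : Fin 2 → Fin p
    ρ = extend x₀ (extend o noVars)
    x₀≡q : value ρ varX ≡ q
    x₀≡q = toℕ-fromℕ< q<p
    dx<p : d * value ρ varX < p
    dx<p = subst (λ v → d * v < p) (sym x₀≡q) dq<p

theorem5p18 : (a d : ℕ) → .{{_ : NonZero a}} → .{{_ : NonZero d}} → a < d →
    Σ Sentence (λ θ → (p : ℕ) → Prime p → d < p → ((p % d ≡ a % d) ⇔ (p ⊨ θ)))
theorem5p18 a d a<d = residueSentence d a , λ p _ d<p →
  ⇔.trans (%≡⇔∃quotient a<d)
          (⇔.sym (⊨residueSentence⇔ p (>-nonZero⁻¹ d) (>-nonZero⁻¹ a) (<-trans a<d d<p)))
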